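{- Let $\mathcal{B}=\{\tilde{\sf c}_i\sim A_i\}_{i\in I}$ be a complete set of axioms whose defined constants $\{\tilde{\sf c}_i\}_{i\in I}$ all lie in the same equivalence class for $\mathcal{B}$, each $A_i$ being of one of the forms $\tilde{\sf c}_i$, $\tilde{\sf c}_j\to\tilde{\sf c}_k$, or $\tilde{\sf c}_j\cap\tilde{\sf c}_k$. Let $\{\tilde{\sf c}_i^{\,p_i}\}_{i\in I}$ with $p_i\in\{+,-\}$ be a decoration of the constants which agrees with $\mathcal{B}$. Then the operator $\Phi_{\mathcal{B}}:\prod_{i\in I}\mathcal{X}_i\to\prod_{i\in I}\mathcal{X}_i$ defined by $\Phi_{\mathcal{B}}(\langle X_i\rangle_{i\in I})=\langle [A_i]\rangle_{i\in I}$, where $[\tilde{\sf c}_i]=X_i$, $[\tilde{\sf c}_j\to\tilde{\sf c}_k]=X_j\Rightarrow X_k$, $[\tilde{\sf c}_j\cap\tilde{\sf c}_k]=X_j\cap X_k$, is monotone with respect to the product order.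
   Context: $\Lambda$ is the set of $\lambda$-terms, $\mathcal{S}$ the solvable terms, $\mathcal{B}_0=\{M\mid M\to^*_\beta xM_1\cdots M_m\}$; $X\subseteq\mathcal{S}$ is saturated if closed under $\beta$-conversion and containing all $xM_1\cdots M_m$. $\mathsf{SAT}$ is the complete lattice of saturated sets $X$ with $\mathcal{B}_0\subseteq X\subseteq\mathcal{S}$ ordered by $\subseteq$; $\mathsf{SAT}^{op}$ is the same set ordered by $\supseteq$. $X\Rightarrow Y=\{M\mid\forall N\in X.\ MN\in Y\}$. In the product, $\mathcal{X}_i=\mathsf{SAT}$ if $p_i=+$ and $\mathcal{X}_i=\mathsf{SAT}^{op}$ if $p_i=-$, ordered componentwise. A set of axioms $\mathcal{A}=\{{\sf c}_i\sim A_i\}_{i\in I}$ consists of formal equations between type constants ${\sf c}_i$ (pairwise distinct) and intersection types $A_i$; the set of constants it defines is $C(\mathcal{A})=\{{\sf c}_i\}_{i\in I}$. $\mathcal{A}$ is complete if every constant occurring in some right-hand side $A_i$ belongs to $C(\mathcal{A})$. For complete $\mathcal{A}$ and ${\sf c}\in C(\mathcal{A})$, the closure $\mathrm{cl}_{\mathcal{A}}({\sf c})$ is $C(\mathcal{A}')$ where $\mathcal{A}'$ is the smallest complete subset of $\mathcal{A}$ with ${\sf c}\in C(\mathcal{A}')$; the equivalence class of ${\sf c}$ for $\mathcal{A}$ is $\{{\sf c}'\in C(\mathcal{A})\mid \mathrm{cl}_{\mathcal{A}}({\sf c})=\mathrm{cl}_{\mathcal{A}}({\sf c}')\}$. Polarities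 $p\in\{+,-,\pm\}$ decorate constants; the predicates on decorated types are the least ones with $\mathbf{Pos}({\sf c}^+)$, $\mathbf{Pos}({\sf c}^\pm)$, $\mathbf{Neg}({\sf c}^-)$, $\mathbf{Neg}({\sf c}^\pm)$, $\mathbf{Neg}(A)\wedge\mathbf{Pos}(B)\Rightarrow\mathbf{Pos}(A\to B)$, $\mathbf{Pos}(A)\wedge\mathbf{Neg}(B)\Rightarrow\mathbf{Neg}(A\to B)$, $\mathbf{Pos}(A)\wedge\mathbf{Pos}(B)\Rightarrow\mathbf{Pos}(A\cap B)$, $\mathbf{Neg}(A)\wedge\mathbf{Neg}(B)\Rightarrow\mathbf{Neg}(A\cap B)$. A decoration $\{{\sf c}_i^{p_i}\}$ agrees with $\mathcal{A}$ if $p_i=+$ implies $\mathbf{Pos}(A_i)$, $p_i=-$ implies $\mathbf{Neg}(A_i)$, and $p_i=\pm$ implies $A_i={\sf c}_i$ (with constants in $A_i$ carrying their decorations). -}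

module Defs where

open import Data.Nat using (ℕ; zero; suc; _+_; _<_; _≤ᵇ_; compare; less; equal; greater)
open import Data.Bool using (if_then_else_)
open import Data.List using (List; []; _∷_)
open import Data.Product using (Σ; _×_; _,_)
open import Data.Sum using (_⊎_)
open import Relation.Binary.PropositionalEquality using (_≡_)
open import Relation.Binary.Construct.Closure.ReflexiveTransitive using (Star)
open import Relation.Binary.Construct.Closure.Equivalence using (EqClosure)

data Term : Set where
  var : ℕ → Term
  lam : Term → Term
  app : Term → Term → Term

shift : ℕ → Term → Term
shift c (var x)   = if c ≤ᵇ x then var (suc x) else var x
shift c (lam M)   = lam (shift (suc c) M)
shift c (app M N) = app (shift c M) (shift c N)

subst : ℕ → Term → Term → Term
subst j N (var x) with compare x j
... | less _ _      = var x
... | equal _       = N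
... | greater _ k   = var (j + k)
subst j N (lam M)   = lam (subst (suc j) (shift 0 N) M)
subst j N (app M P) = app (subst j N M) (subst j N P)

data _→β_ : Term → Term → Set where
  beta : ∀ {M N} → app (lam M) N →β subst 0 N M
  appL : ∀ {M M' N} → M →β M' → app M N →β app M' N
  appR : ∀ {M N N'} → N →β N' → app M N →β app M N'
  abs  : ∀ {M M'} → M →β M' → lam M →β lam M'

_→β*_ : Term → Term → Set
_→β*_ = Star _→β_

_=β_ : Term → Term → Set
_=β_ = EqClosure _→β_

apps : Term → List Term → Term
apps M []       = M
apps M (N ∷ Ns) = apps (app M N) Ns

lams : ℕ → Term → Term
lams zero    M = M
lams (suc n) M = lam (lams n M)

FVBelow : ℕ → Term → Set
FVBelow n (var x)   = x < n
FVBelow n (lam M)   = FVBelow (suc n) M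
FVBelow n (app M N) = FVBelow n M × FVBelow n N

Id : Term
Id = lam (var 0)

Solvable : Term → Set
Solvable M = Σ ℕ λ n → Σ (List Term) λ Ns →
  FVBelow n M × (apps (lams n M) Ns =β Id)

B₀ : Term → Set
B₀ M = Σ Term λ N → (M →β* N) × (Σ ℕ λ x → Σ (List Term) λ Ms → N ≡ apps (var x) Ms)

TSet : Set₁
TSet = Term → Set

_⊆_ : TSet → TSet → Set
X ⊆ Y = ∀ M → X M → Y M

_⇒_ : TSet → TSet → TSet
(X ⇒ Y) M = ∀ N → X N → Y (app M N)

_∩ₛ_ : TSet → TSet → TSet
(X ∩ₛ Y) M = X M × Y M

record Saturated (X : TSet) : Set where
  field
    sat-solvable : X ⊆ Solvable
    sat-conv     : ∀ M N → X M → M =β N → X N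
    sat-hvar     : ∀ x Ms → X (apps (var x) Ms)

record InSAT (X : TSet) : Set where
  field
    saturated : Saturated X
    B₀⊆X      : B₀ ⊆ X

data Ty (C : Set) : Set where
  con  : C → Ty C
  _⟶_  : Ty C → Ty C → Ty C
  _∩_  : Ty C → Ty C → Ty C

data Occurs {C : Set} (c : C) : Ty C → Set where
  here : Occurs c (con c)
  arL  : ∀ {A B} → Occurs c A → Occurs c (A ⟶ B)
  arR  : ∀ {A B} → Occurs c B → Occurs c (A ⟶ B)
  inL  : ∀ {A B} → Occurs c A → Occurs c (A ∩ B)
  inR  : ∀ {A B} → Occurs c B → Occurs c (A ∩ B)

-- A set of axioms {cᵢ ∼ Aᵢ}_{i∈I}: constants are the indices i : I
-- (hence pairwise distinct), and every constant in a right-hand side is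
-- some c_j with j ∈ I (so the axiom set is complete by construction).
Axioms : Set → Set
Axioms I = I → Ty I

-- k ∈ cl(i): k belongs to every complete sub-axiom-set containing i,
-- i.e. to the constants of the smallest complete subset containing i.
InClosure : {I : Set} → Axioms I → I → I → Set₁
InClosure {I} 𝒜 i k =
  (S : I → Set) → S i → (∀ a b → S a → Occurs b (𝒜 a) → S b) → S k

SameClass : {I : Set} → Axioms I → I → I → Set₁
SameClass 𝒜 i j = ∀ k → (InClosure 𝒜 i k → InClosure 𝒜 j k) × (InClosure 𝒜 j k → InClosure 𝒜 i k)

data SimpleForm {I : Set} (i : I) : Ty I → Set where
  self  : SimpleForm i (con i)
  arrow : ∀ j k → SimpleForm i (con j ⟶ con k)
  inter : ∀ j k → SimpleForm i (con j ∩ con k)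

data Pol : Set where
  ⊕ ⊖ ⊕⊖ : Pol

data Pos {I : Set} (p : I → Pol) : Ty I → Set
data Neg {I : Set} (p : I → Pol) : Ty I → Set
data Pos {I} p where
  pos-c   : ∀ {c} → p c ≡ ⊕ → Pos p (con c)
  pos-cpm : ∀ {c} → p c ≡ ⊕⊖ → Pos p (con c)
  pos-→   : ∀ {A B} → Neg p A → Pos p B → Pos p (A ⟶ B)
  pos-∩   : ∀ {A B} → Pos p A → Pos p B → Pos p (A ∩ B)
data Neg {I} p where
  neg-c   : ∀ {c} → p c ≡ ⊖ → Neg p (con c)
  neg-cpm : ∀ {c} → p c ≡ ⊕⊖ → Neg p (con c)
  neg-→   : ∀ {A B} → Pos p A → Neg p B → Neg p (A ⟶ B)
  neg-∩   : ∀ {A B} → Neg p A → Neg p B → Neg p (A ∩ B)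

record Agrees {I : Set} (𝒜 : Axioms I) (p : I → Pol) : Set where
  field
    agree-⊕  : ∀ i → p i ≡ ⊕ → Pos p (𝒜 i)
    agree-⊖  : ∀ i → p i ≡ ⊖ → Neg p (𝒜 i)
    agree-⊕⊖ : ∀ i → p i ≡ ⊕⊖ → 𝒜 i ≡ con i

-- tuples ⟨Xᵢ⟩ with each Xᵢ ∈ SAT (same carrier for SAT and SAT^op)
InProduct : {I : Set} → (I → TSet) → Set
InProduct {I} X = ∀ i → InSAT (X i)

_≤[_]_ : {I : Set} → (I → TSet) → (I → Pol) → (I → TSet) → Set
_≤[_]_ {I} X p Y = ∀ i → (p i ≡ ⊕ → X i ⊆ Y i) × (p i ≡ ⊖ → Y i ⊆ X i)

⟦_⟧ : {I : Set} → Ty I → (I → TSet) → TSet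
⟦ con c ⟧ X = X c
⟦ A ⟶ B ⟧ X = ⟦ A ⟧ X ⇒ ⟦ B ⟧ X
⟦ A ∩ B ⟧ X = ⟦ A ⟧ X ∩ₛ ⟦ B ⟧ X

Φ : {I : Set} → Axioms I → (I → TSet) → (I → TSet)
Φ 𝒜 X i = ⟦ 𝒜 i ⟧ X

{-# OPTIONS --safe #-}
-- By induction on types, a positive type denotes a monotone and a negative type
-- an antitone function of the tuple ⟨Xᵢ⟩, because X ⇒ Y is antitone in X and
-- monotone in Y while ∩ is monotone in both.  Agreement says that each Aᵢ has
-- the variance of its constant, which is exactly monotonicity of Φ.
module Submission where

open import Defs
open import Data.Sum using (_⊎_; inj₁; inj₂)
open import Data.Product using (_,_; proj₁; proj₂)
open import Relation.Binary.PropositionalEquality using (_≡_; _≢_; trans; sym)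

⇒-mono : ∀ {X X′ Y Y′} → X′ ⊆ X → Y ⊆ Y′ → (X ⇒ Y) ⊆ (X′ ⇒ Y′)
⇒-mono X′⊆X Y⊆Y′ M M∈X⇒Y N N∈X′ = Y⊆Y′ (app M N) (M∈X⇒Y N (X′⊆X N N∈X′))

∩ₛ-mono : ∀ {X X′ Y Y′} → X ⊆ X′ → Y ⊆ Y′ → (X ∩ₛ Y) ⊆ (X′ ∩ₛ Y′)
∩ₛ-mono X⊆X′ Y⊆Y′ M (M∈X , M∈Y) = X⊆X′ M M∈X , Y⊆Y′ M M∈Y

module _ {I : Set} {p : I → Pol} (two-valued : ∀ i → (p i ≡ ⊕) ⊎ (p i ≡ ⊖)) where

  p≢⊕⊖ : ∀ i → p i ≢ ⊕⊖
  p≢⊕⊖ i p≡⊕⊖ with two-valued i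
  ... | inj₁ p≡⊕ with () ← trans (sym p≡⊕⊖) p≡⊕
  ... | inj₂ p≡⊖ with () ← trans (sym p≡⊕⊖) p≡⊖

  module _ {X Y : I → TSet} (X≤Y : X ≤[ p ] Y) where

    Pos⇒⟦⟧-mono : ∀ {A} → Pos p A → ⟦ A ⟧ X ⊆ ⟦ A ⟧ Y
    Neg⇒⟦⟧-anti : ∀ {A} → Neg p A → ⟦ A ⟧ Y ⊆ ⟦ A ⟧ X

    Pos⇒⟦⟧-mono (pos-c {c} p≡⊕)     = proj₁ (X≤Y c) p≡⊕
    Pos⇒⟦⟧-mono (pos-cpm {c} p≡⊕⊖)  with () ← p≢⊕⊖ c p≡⊕⊖
    Pos⇒⟦⟧-mono (pos-→ negA posB)   = ⇒-mono (Neg⇒⟦⟧-anti negA) (Pos⇒⟦⟧-mono posB)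
    Pos⇒⟦⟧-mono (pos-∩ posA posB)   = ∩ₛ-mono (Pos⇒⟦⟧-mono posA) (Pos⇒⟦⟧-mono posB)

    Neg⇒⟦⟧-anti (neg-c {c} p≡⊖)     = proj₂ (X≤Y c) p≡⊖
    Neg⇒⟦⟧-anti (neg-cpm {c} p≡⊕⊖)  with () ← p≢⊕⊖ c p≡⊕⊖
    Neg⇒⟦⟧-anti (neg-→ posA negB)   = ⇒-mono (Pos⇒⟦⟧-mono posA) (Neg⇒⟦⟧-anti negB)
    Neg⇒⟦⟧-anti (neg-∩ negA negB)   = ∩ₛ-mono (Neg⇒⟦⟧-anti negA) (Neg⇒⟦⟧-anti negB)

proposition48 : {I : Set} (𝓑 : Axioms I) (p : I → Pol)
    → (∀ i j → SameClass 𝓑 i j)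
    → (∀ i → SimpleForm i (𝓑 i))
    → (∀ i → (p i ≡ ⊕) ⊎ (p i ≡ ⊖))
    → Agrees 𝓑 p
    → (X Y : I → TSet) → InProduct X → InProduct Y
    → X ≤[ p ] Y → Φ 𝓑 X ≤[ p ] Φ 𝓑 Y
proposition48 𝓑 p _ _ two-valued agrees X Y _ _ X≤Y i =
    (λ p≡⊕ → Pos⇒⟦⟧-mono two-valued X≤Y (agree-⊕ i p≡⊕))
  , (λ p≡⊖ → Neg⇒⟦⟧-anti two-valued X≤Y (agree-⊖ i p≡⊖))
  where open Agrees agrees
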